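{- The class $\mathcal{C}_{\mathbf{K}}$ of all Kripke models and the class $\mathcal{C}_{\mathbf{B}}$ of all symmetric Kripke models both have ULIP.
   Context: Formulas are built from propositional variables, $\bot$, $\to$, $\Box$. Modal depth: $d(p)=d(\bot)=0$, $d(\varphi\to\psi)=\max\{d(\varphi),d(\psi)\}$, $d(\Box\varphi)=d(\varphi)+1$. Positive/negative variable sets: $v^+(p)=\{p\}$, $v^-(p)=\emptyset$; $v^\pm(\bot)=\emptyset$; $v^+(\psi\to\theta)=v^-(\psi)\cup v^+(\theta)$, $v^-(\psi\to\theta)=v^+(\psi)\cup v^-(\theta)$; $v^\pm(\Box\psi)=v^\pm(\psi)$. A Kripke model $(W,\prec,\Vdash)$: $W$ nonempty, $\prec$ a binary relation on $W$, $\Vdash$ satisfaction with usual Boolean clauses and $x\Vdash\Box\varphi$ iff $y\Vdash\varphi$ for all $y\succ x$; it is symmetric if $\prec$ is symmetric. A $(P,Q)$-formula is one with $v^+\subseteq P$, $v^-\subseteq Q$; $F_n^{(P,Q)}$ is a fixed finite set of $(P,Q)$-formulas of depth $\le n$ such that every $(P,Q)$-formula of depth $\le n$ is equivalent in the least normal modal logic $\mathbf{K}$ to a member of it, and $\mathrm{Th}_n^{(P,Q)}(w)=\{\varphi\in F_n^{(P,Q)}:w\Vdash\varphi\}$. A class $\mathcal{C}$ of Kripke models has ULIP if for all finite sets $P_1,P_2,P_3$ (pairwise disjoint) and $Q_1,Q_2,Q_3$ (pairwise disjoint) of variables, all $M=(W,\prec,\Vdash)$, $M'=(W',\prec',\Vdash')$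 in $\mathcal{C}$, $w\in W$, $w'\in W'$ and $m,n\in\omega$: if $\mathrm{Th}_n^{(P_2,Q_2)}(w)\subseteq\mathrm{Th}_n^{(P_2,Q_2)}(w')$, then there are $M^*=(W^*,\prec^*,\Vdash^*)$ in $\mathcal{C}$ and $w^*\in W^*$ with $\mathrm{Th}_n^{(P_1\cup P_2,Q_1\cup Q_2)}(w)\subseteq\mathrm{Th}_n^{(P_1\cup P_2,Q_1\cup Q_2)}(w^*)$ and $\mathrm{Th}_m^{(P_2\cup P_3,Q_2\cup Q_3)}(w^*)\subseteq\mathrm{Th}_m^{(P_2\cup P_3,Q_2\cup Q_3)}(w')$. -}

module Defs where

open import Data.Nat using (ℕ; _≤_; _⊔_; suc; zero)
open import Data.Bool using (Bool; true)
open import Data.List using (List; []; _∷_; _++_)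
open import Data.List.Membership.Propositional using (_∈_)
open import Data.List.Relation.Binary.Subset.Propositional using (_⊆_)
open import Data.Product using (Σ; _×_; _,_)
open import Data.Empty using (⊥)
open import Data.Unit using (⊤)
open import Relation.Binary.PropositionalEquality using (_≡_)

infixr 5 _⇒_

data Fm : Set where
  var : ℕ → Fm
  bot : Fm
  _⇒_ : Fm → Fm → Fm
  □   : Fm → Fm

depth : Fm → ℕ
depth (var p) = 0
depth bot = 0
depth (φ ⇒ ψ) = depth φ ⊔ depth ψ
depth (□ φ) = suc (depth φ)

v⁺ v⁻ : Fm → List ℕ
v⁺ (var p) = p ∷ []
v⁺ bot = []
v⁺ (φ ⇒ ψ) = v⁻ φ ++ v⁺ ψ
v⁺ (□ φ) = v⁺ φ
v⁻ (var p) = []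
v⁻ bot = []
v⁻ (φ ⇒ ψ) = v⁺ φ ++ v⁻ ψ
v⁻ (□ φ) = v⁻ φ

IsPQ : List ℕ → List ℕ → Fm → Set
IsPQ P Q φ = (v⁺ φ ⊆ P) × (v⁻ φ ⊆ Q)

data ⊢K_ : Fm → Set where
  ax1 : ∀ φ ψ → ⊢K (φ ⇒ (ψ ⇒ φ))
  ax2 : ∀ φ ψ χ → ⊢K ((φ ⇒ (ψ ⇒ χ)) ⇒ ((φ ⇒ ψ) ⇒ (φ ⇒ χ)))
  ax3 : ∀ φ → ⊢K (((φ ⇒ bot) ⇒ bot) ⇒ φ)
  axK : ∀ φ ψ → ⊢K (□ (φ ⇒ ψ) ⇒ (□ φ ⇒ □ ψ))
  mp  : ∀ {φ ψ} → ⊢K (φ ⇒ ψ) → ⊢K φ → ⊢K ψ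
  nec : ∀ {φ} → ⊢K φ → ⊢K (□ φ)

K-equiv : Fm → Fm → Set
K-equiv φ ψ = (⊢K (φ ⇒ ψ)) × (⊢K (ψ ⇒ φ))

record KModel : Set₁ where
  field
    W   : Set
    R   : W → W → Set
    val : W → ℕ → Bool

open KModel public

_,_⊩_ : (M : KModel) → W M → Fm → Set
M , x ⊩ var p = val M x p ≡ true
M , x ⊩ bot = ⊥
M , x ⊩ (φ ⇒ ψ) = M , x ⊩ φ → M , x ⊩ ψ
M , x ⊩ □ φ = ∀ y → R M x y → M , y ⊩ φ

Symmetric : KModel → Set
Symmetric M = ∀ x y → R M x y → R M y x

ModelClass : Set₁
ModelClass = KModel → Set

C-K : ModelClass
C-K M = ⊤

C-B : ModelClass
C-B M = Symmetric M

-- F : a choice of the fixed finite sets F_n^(P,Q)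

IsFSystem : (List ℕ → List ℕ → ℕ → List Fm) → Set
IsFSystem F = ∀ P Q n →
  (∀ φ → φ ∈ F P Q n → IsPQ P Q φ × depth φ ≤ n) ×
  (∀ φ → IsPQ P Q φ → depth φ ≤ n → Σ Fm λ ψ → ψ ∈ F P Q n × K-equiv φ ψ)

ThSub : (List ℕ → List ℕ → ℕ → List Fm) → List ℕ → List ℕ → ℕ →
        (M : KModel) → W M → (M' : KModel) → W M' → Set
ThSub F P Q n M w M' w' = ∀ φ → φ ∈ F P Q n → M , w ⊩ φ → M' , w' ⊩ φ

Disjoint : List ℕ → List ℕ → Set
Disjoint A B = ∀ x → x ∈ A → x ∈ B → ⊥

PairwiseDisjoint : List ℕ → List ℕ → List ℕ → Set
PairwiseDisjoint A B C = Disjoint A B × Disjoint A C × Disjoint B C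

ULIP : (List ℕ → List ℕ → ℕ → List Fm) → ModelClass → Set₁
ULIP F C =
  ∀ (P₁ P₂ P₃ Q₁ Q₂ Q₃ : List ℕ) →
  PairwiseDisjoint P₁ P₂ P₃ → PairwiseDisjoint Q₁ Q₂ Q₃ →
  (M M' : KModel) → C M → C M' → (w : W M) (w' : W M') (m n : ℕ) →
  ThSub F P₂ Q₂ n M w M' w' →
  Σ KModel λ M* → C M* × Σ (W M*) λ w* →
    ThSub F (P₁ ++ P₂) (Q₁ ++ Q₂) n M w M* w* ×
    ThSub F (P₂ ++ P₃) (Q₂ ++ Q₃) m M* w* M' w'

-- Theory inclusion up to depth n is a graded directed bisimulation: atoms in P
-- are preserved forwards, atoms in Q backwards, and (classically) every
-- successor on either side is matched one level lower.  Such a bisimulation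
-- transfers (P,Q)-formulas forwards and (Q,P)-formulas backwards.  Given one
-- between M and M' for (P₂,Q₂), the amalgam M* has as worlds the triples
-- (x, x', j) with x, x' linked at level j, related when both components are
-- and the levels differ by one, plus a copy of M' seen from the level-0
-- triples.  A variable holds at (x, x', j) if it lies in P₁ ∪ P₂ and holds at
-- x, or lies in Q₂ ∪ Q₃ and holds at x'.  Then x ↦ (x, x', j) is a
-- (P₁∪P₂, Q₁∪Q₂)-bisimulation up to level j and the projection to M' a
-- (P₂∪P₃, Q₂∪Q₃)-bisimulation at every level; disjointness of P₁, P₃ and of
-- Q₁, Q₃ is what makes the valuation compatible with both.  The construction
-- is symmetric whenever M and M' are, which gives the result for 𝐁.
module Submission where

open import Defs
open import Level using (0ℓ)
open import Data.Nat using (ℕ; zero; suc; _≤_; z≤n; s≤s; _≟_)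
open import Data.Nat.Properties using (≤-refl; m≤n⇒m≤1+n; ⊔-lub; m⊔n≤o⇒m≤o; m⊔n≤o⇒n≤o)
open import Data.Bool using (Bool; true; false)
import Data.Bool as Bool
open import Data.Bool.Properties using (∨-zeroʳ)
open import Data.List using (List; []; _∷_; _++_)
open import Data.List.Membership.Propositional using (_∈_)
open import Data.List.Membership.DecPropositional _≟_ using (_∈?_)
open import Data.List.Membership.Propositional.Properties using (∈-++⁻)
open import Data.List.Relation.Binary.Subset.Propositional using (_⊆_)
open import Data.List.Relation.Binary.Subset.Propositional.Properties
  using (⊆-trans; xs⊆xs++ys; xs⊆ys++xs)
open import Data.List.Relation.Unary.All using (All; []; _∷_; tabulate)
open import Data.List.Relation.Unary.Any using (here; there)
open import Data.Product using (Σ; _×_; _,_; proj₁; proj₂)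
open import Data.Sum using (_⊎_; inj₁; inj₂; [_,_]′)
open import Data.Empty using (⊥; ⊥-elim)
open import Data.Unit using (tt)
open import Effect.Monad using (RawMonad)
open import Function using (id; _∘_)
open import Relation.Nullary using (¬_; Dec; yes; no; does)
open import Relation.Nullary.Decidable using (dec-true; decidable-stable; ¬¬-excluded-middle)
open import Relation.Nullary.Negation using (¬¬-Monad; ¬¬-map)
open import Relation.Binary.PropositionalEquality using (_≡_; refl)

open RawMonad (¬¬-Monad {a = 0ℓ}) using (_>>=_; pure)

⊩-stable : ∀ M x φ → ¬ ¬ (M , x ⊩ φ) → M , x ⊩ φ
⊩-stable M x (var p) = decidable-stable (val M x p Bool.≟ true)
⊩-stable M x bot ¬¬⊥ = ¬¬⊥ id
⊩-stable M x (φ ⇒ ψ) ¬¬h xφ = ⊩-stable M x ψ (¬¬-map (λ h → h xφ) ¬¬h)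
⊩-stable M x (□ φ) ¬¬h y r = ⊩-stable M y φ (¬¬-map (λ h → h y r) ¬¬h)

⊢K-sound : ∀ {φ} → ⊢K φ → ∀ M x → M , x ⊩ φ
⊢K-sound (ax1 φ ψ) M x a _ = a
⊢K-sound (ax2 φ ψ χ) M x f g a = f a (g a)
⊢K-sound (ax3 φ) M x = ⊩-stable M x φ
⊢K-sound (axK φ ψ) M x f g y r = f y r (g y r)
⊢K-sound (mp ⊢φ⇒ψ ⊢φ) M x = ⊢K-sound ⊢φ⇒ψ M x (⊢K-sound ⊢φ M x)
⊢K-sound (nec ⊢φ) M x y _ = ⊢K-sound ⊢φ M y

IsPQ≤ : List ℕ → List ℕ → ℕ → Fm → Set
IsPQ≤ P Q n φ = IsPQ P Q φ × depth φ ≤ n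

module _ {F : List ℕ → List ℕ → ℕ → List Fm} (isF : IsFSystem F)
         {P Q : List ℕ} {n : ℕ} {M N : KModel} {x : W M} {y : W N} where

  ThSub-transfer : ThSub F P Q n M x N y →
    ∀ {φ} → IsPQ≤ P Q n φ → M , x ⊩ φ → N , y ⊩ φ
  ThSub-transfer x≤y {φ} (pq , d) xφ with proj₂ (isF P Q n) φ pq d
  ... | ψ , ψ∈F , ⊢φ⇒ψ , ⊢ψ⇒φ = ⊢K-sound ⊢ψ⇒φ N y (x≤y ψ ψ∈F (⊢K-sound ⊢φ⇒ψ M x xφ))

  ThSub-intro : (∀ {φ} → IsPQ≤ P Q n φ → M , x ⊩ φ → N , y ⊩ φ) → ThSub F P Q n M x N y
  ThSub-intro transfer φ φ∈F = transfer (proj₁ (isF P Q n) φ φ∈F)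

++-⊆ : {xs ys zs : List ℕ} → xs ⊆ zs → ys ⊆ zs → xs ++ ys ⊆ zs
++-⊆ {xs} xs⊆zs ys⊆zs = [ xs⊆zs , ys⊆zs ]′ ∘ ∈-++⁻ xs

module _ {P Q : List ℕ} where

  IsPQ-var : ∀ {p} → p ∈ P → IsPQ P Q (var p)
  IsPQ-var p∈P = (λ { (here refl) → p∈P }) , λ ()

  IsPQ-bot : IsPQ P Q bot
  IsPQ-bot = (λ ()) , (λ ())

  IsPQ-⇒⁺ : ∀ φ ψ → IsPQ Q P φ → IsPQ P Q ψ → IsPQ P Q (φ ⇒ ψ)
  IsPQ-⇒⁺ _ _ (φ⁺ , φ⁻) (ψ⁺ , ψ⁻) = ++-⊆ φ⁻ ψ⁺ , ++-⊆ φ⁺ ψ⁻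

  IsPQ-⇒⁻ : ∀ φ ψ → IsPQ P Q (φ ⇒ ψ) → IsPQ Q P φ × IsPQ P Q ψ
  IsPQ-⇒⁻ φ ψ (φψ⁺ , φψ⁻) =
    (⊆-trans (xs⊆xs++ys _ (v⁻ ψ)) φψ⁻ , ⊆-trans (xs⊆xs++ys _ (v⁺ ψ)) φψ⁺) ,
    (⊆-trans (xs⊆ys++xs _ (v⁻ φ)) φψ⁺ , ⊆-trans (xs⊆ys++xs _ (v⁺ φ)) φψ⁻)

infixr 6 _∧_
infixr 5 _∨_

top : Fm
top = bot ⇒ bot

_∧_ _∨_ : Fm → Fm → Fm
φ ∧ ψ = (φ ⇒ ψ ⇒ bot) ⇒ bot
φ ∨ ψ = (φ ⇒ bot) ⇒ ψ

◇ : Fm → Fm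
◇ φ = □ (φ ⇒ bot) ⇒ bot

⊩-∧⁻ : ∀ M x {φ ψ} → M , x ⊩ (φ ∧ ψ) → (M , x ⊩ φ) × (M , x ⊩ ψ)
⊩-∧⁻ M x {φ} {ψ} h =
  ⊩-stable M x φ (λ ¬φ → h (λ xφ _ → ¬φ xφ)) ,
  ⊩-stable M x ψ (λ ¬ψ → h (λ _ xψ → ¬ψ xψ))

module _ {P Q : List ℕ} {i : ℕ} where

  IsPQ≤-top : IsPQ≤ P Q i top
  IsPQ≤-top = IsPQ-⇒⁺ bot bot IsPQ-bot IsPQ-bot , z≤n

  IsPQ≤-bot : IsPQ≤ P Q i bot
  IsPQ≤-bot = IsPQ-bot , z≤n

  IsPQ≤-∧ : ∀ φ ψ → IsPQ≤ P Q i φ → IsPQ≤ P Q i ψ → IsPQ≤ P Q i (φ ∧ ψ)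
  IsPQ≤-∧ φ ψ (φ± , dφ) (ψ± , dψ) =
    IsPQ-⇒⁺ (φ ⇒ ψ ⇒ bot) bot (IsPQ-⇒⁺ φ (ψ ⇒ bot) φ± (IsPQ-⇒⁺ ψ bot ψ± IsPQ-bot)) IsPQ-bot ,
    ⊔-lub (⊔-lub dφ (⊔-lub dψ z≤n)) z≤n

  IsPQ≤-∨ : ∀ φ ψ → IsPQ≤ P Q i φ → IsPQ≤ P Q i ψ → IsPQ≤ P Q i (φ ∨ ψ)
  IsPQ≤-∨ φ ψ (φ± , dφ) (ψ± , dψ) =
    IsPQ-⇒⁺ (φ ⇒ bot) ψ (IsPQ-⇒⁺ φ bot φ± IsPQ-bot) ψ± , ⊔-lub (⊔-lub dφ z≤n) dψ

  IsPQ≤-◇ : ∀ φ → IsPQ≤ P Q i φ → IsPQ≤ P Q (suc i) (◇ φ)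
  IsPQ≤-◇ φ (φ± , dφ) =
    IsPQ-⇒⁺ (□ (φ ⇒ bot)) bot (IsPQ-⇒⁺ φ bot φ± IsPQ-bot) IsPQ-bot ,
    ⊔-lub (s≤s (⊔-lub dφ z≤n)) z≤n

-- Graded directed bisimulations

-- forth and back hold only up to double negation: for theory inclusion they
-- are proved classically.
record DirectedBisimulation (P Q : List ℕ) (M N : KModel) : Set₁ where
  field
    Z     : ℕ → W M → W N → Set
    atom⁺ : ∀ {i x y p} → Z i x y → p ∈ P → val M x p ≡ true → val N y p ≡ true
    atom⁻ : ∀ {i x y p} → Z i x y → p ∈ Q → val N y p ≡ true → val M x p ≡ true
    forth : ∀ {i x y x₁} → Z (suc i) x y → R M x x₁ →
            ¬ ¬ (Σ (W N) λ y₁ → R N y y₁ × Z i x₁ y₁)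
    back  : ∀ {i x y y₁} → Z (suc i) x y → R N y y₁ →
            ¬ ¬ (Σ (W M) λ x₁ → R M x x₁ × Z i x₁ y₁)

open DirectedBisimulation

swap : ∀ {P Q M N} → DirectedBisimulation P Q M N → DirectedBisimulation Q P N M
swap B = record
  { Z = λ i y x → Z B i x y
  ; atom⁺ = atom⁻ B
  ; atom⁻ = atom⁺ B
  ; forth = back B
  ; back = forth B
  }

⊩-transfer : ∀ {P Q M N} (B : DirectedBisimulation P Q M N) φ {i x y} →
  Z B i x y → IsPQ≤ P Q i φ → M , x ⊩ φ → N , y ⊩ φ
⊩-transfer B (var p) z (pq , _) = atom⁺ B z (proj₁ pq (here refl))
⊩-transfer B bot z _ = id
⊩-transfer B (φ ⇒ ψ) z (pq , d) h yφ =
  ⊩-transfer B ψ z (ψ± , m⊔n≤o⇒n≤o _ _ d)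
    (h (⊩-transfer (swap B) φ z (φ∓ , m⊔n≤o⇒m≤o _ _ d) yφ))
  where
  φ∓ = proj₁ (IsPQ-⇒⁻ φ ψ pq)
  ψ± = proj₂ (IsPQ-⇒⁻ φ ψ pq)
⊩-transfer {N = N} B (□ φ) z (pq , s≤s d) h y₁ r =
  ⊩-stable N y₁ φ λ ¬y₁φ →
    back B z r λ (x₁ , r' , z₁) → ¬y₁φ (⊩-transfer B φ z₁ (pq , d) (h x₁ r'))

-- Theory inclusion is a graded directed bisimulation

module _ {P Q : List ℕ} {i : ℕ} (M N : KModel) where

  ⋀-theory : ∀ y {L} → All (IsPQ≤ P Q i) L →
    ¬ ¬ (Σ Fm λ χ → IsPQ≤ P Q i χ × M , y ⊩ χ ×
         (∀ z → N , z ⊩ χ → ∀ φ → φ ∈ L → M , y ⊩ φ → N , z ⊩ φ))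
  ⋀-theory y [] = pure (top , IsPQ≤-top , id , λ _ _ _ ())
  ⋀-theory y {φ ∷ L} (φ≤ ∷ L≤) = do
    χ , χ≤ , yχ , χ⇒L ← ⋀-theory y L≤
    yes yφ ← ¬¬-excluded-middle {A = M , y ⊩ φ}
      where no ¬yφ → pure (χ , χ≤ , yχ , λ where
              z zχ ψ (here refl) yψ → ⊥-elim (¬yφ yψ)
              z zχ ψ (there ψ∈L) → χ⇒L z zχ ψ ψ∈L)
    pure (χ ∧ φ , IsPQ≤-∧ χ φ χ≤ φ≤ , (λ h → h yχ yφ) , λ where
      z zχφ ψ (here refl) _ → proj₂ (⊩-∧⁻ N z zχφ)
      z zχφ ψ (there ψ∈L) → χ⇒L z (proj₁ (⊩-∧⁻ N z zχφ)) ψ ψ∈L)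

  ⋁-cotheory : ∀ y {L} → All (IsPQ≤ P Q i) L →
    ¬ ¬ (Σ Fm λ δ → IsPQ≤ P Q i δ × ¬ (N , y ⊩ δ) ×
         (∀ z → ¬ (M , z ⊩ δ) → ∀ φ → φ ∈ L → M , z ⊩ φ → N , y ⊩ φ))
  ⋁-cotheory y [] = pure (bot , IsPQ≤-bot , id , λ _ _ _ ())
  ⋁-cotheory y {φ ∷ L} (φ≤ ∷ L≤) = do
    δ , δ≤ , ¬yδ , L⇒δ ← ⋁-cotheory y L≤
    no ¬yφ ← ¬¬-excluded-middle {A = N , y ⊩ φ}
      where yes yφ → pure (δ , δ≤ , ¬yδ , λ where
              z ¬zδ ψ (here refl) _ → yφ
              z ¬zδ ψ (there ψ∈L) → L⇒δ z ¬zδ ψ ψ∈L)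
    pure (φ ∨ δ , IsPQ≤-∨ φ δ φ≤ δ≤ , (λ h → ¬yδ (h ¬yφ)) , λ where
      z ¬zφ∨δ ψ (here refl) zψ → ⊥-elim (¬zφ∨δ λ ¬zψ → ⊥-elim (¬zψ zψ))
      z ¬zφ∨δ ψ (there ψ∈L) → L⇒δ z (λ zδ → ¬zφ∨δ λ _ → zδ) ψ ψ∈L)

module _ {F : List ℕ → List ℕ → ℕ → List Fm} (isF : IsFSystem F)
         {P Q : List ℕ} {M N : KModel} where

  F-bounded : ∀ i → All (IsPQ≤ P Q i) (F P Q i)
  F-bounded i = tabulate λ {φ} → proj₁ (isF P Q i) φ

  ThSub-atom⁻ : ∀ {i x y p} → ThSub F P Q i M x N y → p ∈ Q →
    val N y p ≡ true → val M x p ≡ true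
  ThSub-atom⁻ {x = x} {p = p} x≤y p∈Q yp = decidable-stable (val M x p Bool.≟ true) λ ¬xp →
    ThSub-transfer isF x≤y {var p ⇒ bot} ¬p≤ ¬xp yp
    where
    ¬p≤ : ∀ {i} → IsPQ≤ P Q i (var p ⇒ bot)
    ¬p≤ = IsPQ-⇒⁺ (var p) bot (IsPQ-var p∈Q) IsPQ-bot , z≤n

  ThSub-forth : ∀ {i x y x₁} → ThSub F P Q (suc i) M x N y → R M x x₁ →
    ¬ ¬ (Σ (W N) λ y₁ → R N y y₁ × ThSub F P Q i M x₁ N y₁)
  ThSub-forth {i} {x₁ = x₁} x≤y r k =
    ⋀-theory M N x₁ (F-bounded i) λ (χ , χ≤ , x₁χ , χ⇒Th) →
    ThSub-transfer isF x≤y {◇ χ} (IsPQ≤-◇ χ χ≤) (λ h → h x₁ r x₁χ)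
      λ y₁ r' y₁χ → k (y₁ , r' , χ⇒Th y₁ y₁χ)

  -- if no successor of x matched y₁, then □δ would hold at x, hence at y
  ThSub-back : ∀ {i x y y₁} → ThSub F P Q (suc i) M x N y → R N y y₁ →
    ¬ ¬ (Σ (W M) λ x₁ → R M x x₁ × ThSub F P Q i M x₁ N y₁)
  ThSub-back {i} {y₁ = y₁} x≤y r' k =
    ⋁-cotheory M N y₁ (F-bounded i) λ (δ , (δ± , dδ) , ¬y₁δ , Th⇒δ) →
    ¬y₁δ (ThSub-transfer isF x≤y {□ δ} (δ± , s≤s dδ)
      (λ x₁ r → ⊩-stable M x₁ δ λ ¬x₁δ → k (x₁ , r , Th⇒δ x₁ ¬x₁δ)) y₁ r')

  ThSub-directedBisimulation : DirectedBisimulation P Q M N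
  ThSub-directedBisimulation = record
    { Z = λ i x y → ThSub F P Q i M x N y
    ; atom⁺ = λ {_} {_} {_} {p} x≤y p∈P →
        ThSub-transfer isF x≤y {var p} (IsPQ-var p∈P , z≤n)
    ; atom⁻ = ThSub-atom⁻
    ; forth = ThSub-forth
    ; back = ThSub-back
    }

-- The amalgam

∈-++-overlap : {A B C : List ℕ} {p : ℕ} → Disjoint A C → p ∈ A ++ B → p ∈ B ++ C → p ∈ B
∈-++-overlap {A} {B} A#C p∈AB p∈BC with ∈-++⁻ A p∈AB | ∈-++⁻ B p∈BC
... | inj₂ p∈B | _         = p∈B
... | inj₁ _   | inj₁ p∈B  = p∈B
... | inj₁ p∈A | inj₂ p∈C  = ⊥-elim (A#C _ p∈A p∈C)

∨∧-true⁻ : {A B : Set} (a? : Dec A) (b? : Dec B) (u v : Bool) →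
  ((does a? Bool.∧ u) Bool.∨ (does b? Bool.∧ v)) ≡ true →
  (A × u ≡ true) ⊎ (B × v ≡ true)
∨∧-true⁻ (yes a) _       true  _     _ = inj₁ (a , refl)
∨∧-true⁻ (yes _) (yes b) false true  _ = inj₂ (b , refl)
∨∧-true⁻ (no _)  (yes b) _     true  _ = inj₂ (b , refl)
∨∧-true⁻ (yes _) (yes _) false false ()
∨∧-true⁻ (yes _) (no _)  false _     ()
∨∧-true⁻ (no _)  (yes _) _     false ()
∨∧-true⁻ (no _)  (no _)  _     _     ()

module Amalgam (P₁ P₂ P₃ Q₁ Q₂ Q₃ : List ℕ)
               (P₁#P₃ : Disjoint P₁ P₃) (Q₁#Q₃ : Disjoint Q₁ Q₃)
               {M M' : KModel} (B : DirectedBisimulation P₂ Q₂ M M') where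

  data World : Set where
    pair  : (x : W M) (x' : W M') (j : ℕ) → Z B j x x' → World
    right : W M' → World

  _≺_ : World → World → Set
  pair x x' j _ ≺ pair y y' k _ = R M x y × R M' x' y' × (suc k ≡ j ⊎ suc j ≡ k)
  pair x x' j _ ≺ right y'      = R M' x' y' × j ≡ 0
  right x'      ≺ pair y y' k _ = R M' x' y' × k ≡ 0
  right x'      ≺ right y'      = R M' x' y'

  valuation : World → ℕ → Bool
  valuation (pair x x' _ _) p =
    (does (p ∈? P₁ ++ P₂) Bool.∧ val M x p) Bool.∨ (does (p ∈? Q₂ ++ Q₃) Bool.∧ val M' x' p)
  valuation (right x') p = val M' x' p

  model : KModel
  model = record { W = World ; R = _≺_ ; val = valuation }

  ≺-symmetric : Symmetric M → Symmetric M' → Symmetric model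
  ≺-symmetric s s' (pair x x' _ _) (pair y y' _ _) (r , r' , inj₁ e) = s x y r , s' x' y' r' , inj₂ e
  ≺-symmetric s s' (pair x x' _ _) (pair y y' _ _) (r , r' , inj₂ e) = s x y r , s' x' y' r' , inj₁ e
  ≺-symmetric s s' (pair _ x' _ _) (right y')      (r' , e)          = s' x' y' r' , e
  ≺-symmetric s s' (right x')      (pair _ y' _ _) (r' , e)          = s' x' y' r' , e
  ≺-symmetric s s' (right x')      (right y')      r'                = s' x' y' r'

  proj : World → W M'
  proj (pair _ x' _ _) = x'
  proj (right x')      = x'

  proj-≺ : ∀ a b → a ≺ b → R M' (proj a) (proj b)
  proj-≺ (pair _ _ _ _) (pair _ _ _ _) (_ , r' , _) = r'
  proj-≺ (pair _ _ _ _) (right _)      (r' , _)     = r'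
  proj-≺ (right _)      (pair _ _ _ _) (r' , _)     = r'
  proj-≺ (right _)      (right _)      r'           = r'

  module _ {x : W M} {x' : W M'} {j p : ℕ} (xZx' : Z B j x x') where

    valuation-true⁻ : valuation (pair x x' j xZx') p ≡ true →
      (p ∈ P₁ ++ P₂ × val M x p ≡ true) ⊎ (p ∈ Q₂ ++ Q₃ × val M' x' p ≡ true)
    valuation-true⁻ = ∨∧-true⁻ (p ∈? P₁ ++ P₂) (p ∈? Q₂ ++ Q₃) (val M x p) (val M' x' p)

    valuation-P₁₂ : p ∈ P₁ ++ P₂ → val M x p ≡ true → valuation (pair x x' j xZx') p ≡ true
    valuation-P₁₂ p∈ xp rewrite dec-true (p ∈? P₁ ++ P₂) p∈ | xp = refl

    valuation-Q₂₃ : p ∈ Q₂ ++ Q₃ → val M' x' p ≡ true → valuation (pair x x' j xZx') p ≡ true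
    valuation-Q₂₃ p∈ x'p rewrite dec-true (p ∈? Q₂ ++ Q₃) p∈ | x'p = ∨-zeroʳ _

    valuation-Q₁₂ : p ∈ Q₁ ++ Q₂ → valuation (pair x x' j xZx') p ≡ true → val M x p ≡ true
    valuation-Q₁₂ p∈ ap with valuation-true⁻ ap
    ... | inj₁ (_ , xp)      = xp
    ... | inj₂ (p∈' , x'p)   = atom⁻ B xZx' (∈-++-overlap Q₁#Q₃ p∈ p∈') x'p

    valuation-P₂₃ : p ∈ P₂ ++ P₃ → valuation (pair x x' j xZx') p ≡ true → val M' x' p ≡ true
    valuation-P₂₃ p∈ ap with valuation-true⁻ ap
    ... | inj₁ (p∈' , xp)    = atom⁺ B xZx' (∈-++-overlap P₁#P₃ p∈' p∈) xp
    ... | inj₂ (_ , x'p)     = x'p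

  -- a pair of level k stays linked at every level i ≤ k, since a successor
  -- of a pair may sit one level higher
  Embeds : ℕ → W M → World → Set
  Embeds i x (pair y _ k _) = x ≡ y × i ≤ k
  Embeds i x (right _)      = ⊥

  Embeds-forth : ∀ {i x y} a → Embeds (suc i) x a → R M x y →
    ¬ ¬ (Σ World λ b → a ≺ b × Embeds i y b)
  Embeds-forth (pair x x' (suc k) xZx') (refl , s≤s i≤k) r = do
    y' , r' , yZy' ← forth B xZx' r
    pure (pair _ y' k yZy' , (r , r' , inj₁ refl) , refl , i≤k)

  Embeds-back : ∀ {i x} a b → Embeds (suc i) x a → a ≺ b →
    ¬ ¬ (Σ (W M) λ y → R M x y × Embeds i y b)
  Embeds-back (pair _ _ (suc k) _) (pair y _ _ _) (refl , s≤s i≤k) (r , _ , inj₁ refl) =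
    pure (y , r , refl , i≤k)
  Embeds-back (pair _ _ (suc k) _) (pair y _ _ _) (refl , s≤s i≤k) (r , _ , inj₂ refl) =
    pure (y , r , refl , m≤n⇒m≤1+n (m≤n⇒m≤1+n i≤k))
  Embeds-back (pair _ _ (suc k) _) (right _) (refl , _) (_ , ())

  embedding : DirectedBisimulation (P₁ ++ P₂) (Q₁ ++ Q₂) M model
  embedding = record
    { Z = Embeds
    ; atom⁺ = λ { {y = pair _ _ _ xZx'} (refl , _) → valuation-P₁₂ xZx' }
    ; atom⁻ = λ { {y = pair _ _ _ xZx'} (refl , _) → valuation-Q₁₂ xZx' }
    ; forth = λ {_} {_} {a} → Embeds-forth a
    ; back = λ {_} {_} {a} {b} → Embeds-back a b
    }

  proj-back : ∀ a {y'} → R M' (proj a) y' → ¬ ¬ (Σ World λ b → a ≺ b × proj b ≡ y')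
  proj-back (pair _ _ zero _) {y'} r' = pure (right y' , (r' , refl) , refl)
  proj-back (pair _ _ (suc k) xZx') {y'} r' = do
    y , r , yZy' ← back B xZx' r'
    pure (pair y y' k yZy' , (r , r' , inj₁ refl) , refl)
  proj-back (right _) {y'} r' = pure (right y' , r' , refl)

  projection : DirectedBisimulation (P₂ ++ P₃) (Q₂ ++ Q₃) model M'
  projection = record
    { Z = λ _ a x' → proj a ≡ x'
    ; atom⁺ = λ { {x = pair _ _ _ xZx'} refl → valuation-P₂₃ xZx'
                ; {x = right _} refl _ → id }
    ; atom⁻ = λ { {x = pair _ _ _ xZx'} refl → valuation-Q₂₃ xZx'
                ; {x = right _} refl _ → id }
    ; forth = λ { {x = a} {x₁ = b} refl a≺b → pure (proj b , proj-≺ a b a≺b , refl) }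
    ; back = λ { {x = a} refl → proj-back a }
    }

ClosedUnderAmalgam : ModelClass → Set₁
ClosedUnderAmalgam C =
  ∀ {P₁ P₂ P₃ Q₁ Q₂ Q₃ : List ℕ} {P₁#P₃ : Disjoint P₁ P₃} {Q₁#Q₃ : Disjoint Q₁ Q₃}
    {M M'} (B : DirectedBisimulation P₂ Q₂ M M') →
    C M → C M' → C (Amalgam.model P₁ P₂ P₃ Q₁ Q₂ Q₃ P₁#P₃ Q₁#Q₃ B)

C-B-closedUnderAmalgam : ClosedUnderAmalgam C-B
C-B-closedUnderAmalgam {P₁} {P₂} {P₃} {Q₁} {Q₂} {Q₃} {P₁#P₃} {Q₁#Q₃} B =
  Amalgam.≺-symmetric P₁ P₂ P₃ Q₁ Q₂ Q₃ P₁#P₃ Q₁#Q₃ B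

ULIP-closedUnderAmalgam : ∀ F → IsFSystem F → ∀ C → ClosedUnderAmalgam C → ULIP F C
ULIP-closedUnderAmalgam F isF C closed
  P₁ P₂ P₃ Q₁ Q₂ Q₃ (_ , P₁#P₃ , _) (_ , Q₁#Q₃ , _) M M' CM CM' w w' m n w≤w' =
  model , closed {P₁} {P₂} {P₃} {Q₁} {Q₂} {Q₃} {P₁#P₃} {Q₁#Q₃} B CM CM' , pair w w' n w≤w' ,
  ThSub-intro isF (⊩-transfer embedding _ (refl , ≤-refl)) ,
  ThSub-intro isF (⊩-transfer projection _ refl)
  where
  B = ThSub-directedBisimulation isF
  open Amalgam P₁ P₂ P₃ Q₁ Q₂ Q₃ P₁#P₃ Q₁#Q₃ B

lemma4p5 : (F : List ℕ → List ℕ → ℕ → List Fm) → IsFSystem F →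
    ULIP F C-K × ULIP F C-B
lemma4p5 F isF =
  ULIP-closedUnderAmalgam F isF C-K (λ _ _ _ → tt) ,
  ULIP-closedUnderAmalgam F isF C-B C-B-closedUnderAmalgam
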